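{- For any monoid $M$ and any $k\ge0$, the equivalence relation $\equiv_{\mathrm{first}_k}$ on $\mathbf{P}(M)$, relating $\mathfrak{p},\mathfrak{p}'$ of the same arity whenever $\mathrm{first}_k(\mathfrak{p})=\mathrm{first}_k(\mathfrak{p}')$, is a clone congruence of $\mathbf{P}(M)$.
   Context: For a monoid $(M,\cdot,e)$: an $M$-pigmented letter is a pair $i^\alpha$ ($i\ge1$ an integer called the value, $\alpha\in M$); $\mathbf{P}(M)(n)$ is the set of words of $M$-pigmented letters with values in $[n]$. For $\alpha\in M$, $\alpha\odot i_1^{\alpha_1}\cdots i_\ell^{\alpha_\ell}:=i_1^{\alpha\cdot\alpha_1}\cdots i_\ell^{\alpha\cdot\alpha_\ell}$. The clone $\mathbf{P}(M)$ has superposition $i_1^{\alpha_1}\cdots i_\ell^{\alpha_\ell}[\mathfrak{p}_1,\dots,\mathfrak{p}_n]:=(\alpha_1\odot\mathfrak{p}_{i_1})\cdots(\alpha_\ell\odot\mathfrak{p}_{i_\ell})$ and projections $i^e$. A position $j$ of a word $\mathfrak{p}$ is a left $k$-witness if among the letters at positions $1,\dots,j-1$ at most $k-1$ have the same value as $\mathfrak{p}(j)$; $\mathrm{first}_k(\mathfrak{p})$ is the subword of $\mathfrak{p}$ formed by the letters at left $k$-witness positions. A clone congruence is an arity-preserving equivalence relation such that $x\equiv x'$ and $y_j\equiv y'_j$ for all $j$ imply $x[y_1,\dots,y_n]\equiv x'[y'_1,\dots,y'_n]$. -}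

module Defs where

open import Level using (Level)
open import Algebra.Bundles using (Monoid)
open import Data.Nat using (ℕ; _<_)
open import Data.Fin using (Fin; _≟_)
open import Data.Product using (_×_; _,_; proj₁; proj₂)
open import Data.List using (List; []; _∷_; _++_; map; concatMap; length; filter)
open import Data.List.Relation.Binary.Pointwise using (Pointwise)
open import Relation.Binary.PropositionalEquality using (_≡_)
open import Relation.Nullary using (Dec; yes; no)
open import Data.Nat using (_<?_)

module Pigmented {c ℓ : Level} (M : Monoid c ℓ) where
  open Monoid M renaming (Carrier to A)

  -- An M-pigmented letter with value in [n] (values encoded as Fin n,
  -- i.e. value i+1 is represented by the element i of Fin n).
  Letter : ℕ → Set c
  Letter n = Fin n × A

  P : ℕ → Set c
  P n = List (Letter n)

  _⊙_ : ∀ {n} → A → P n → P n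
  α ⊙ w = map (λ l → proj₁ l , α ∙ proj₂ l) w

  _[_] : ∀ {n m} → P n → (Fin n → P m) → P m
  x [ ys ] = concatMap (λ l → proj₂ l ⊙ ys (proj₁ l)) x

  proj : ∀ {n} → Fin n → P n
  proj i = (i , ε) ∷ []

  count : ∀ {n} → Fin n → P n → ℕ
  count i [] = 0
  count i ((j , _) ∷ w) with i ≟ j
  ... | yes _ = Data.Nat.suc (count i w)
  ... | no _  = count i w

  firstAux : ∀ {n} → ℕ → P n → P n → P n
  firstAux k pre [] = []
  firstAux k pre (l ∷ w) with count (proj₁ l) pre <? k
  ... | yes _ = l ∷ firstAux k (pre ++ (l ∷ [])) w
  ... | no _  = firstAux k (pre ++ (l ∷ [])) w

  first : ∀ {n} → ℕ → P n → P n
  first k w = firstAux k [] w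

  _≈L_ : ∀ {n} → Letter n → Letter n → Set ℓ
  (i , α) ≈L (j , β) = (i ≡ j) × (α ≈ β)

  _≈W_ : ∀ {n} → P n → P n → Set (c Level.⊔ ℓ)
  _≈W_ = Pointwise _≈L_

  _≡first[_]_ : ∀ {n} → P n → ℕ → P n → Set (c Level.⊔ ℓ)
  p ≡first[ k ] p' = first k p ≈W first k p'

module _ {c ℓ : Level} (M : Monoid c ℓ) where
  open Pigmented M
  IsCloneCongruence : (∀ {n} → P n → P n → Set (c Level.⊔ ℓ)) → Set (c Level.⊔ ℓ)
  IsCloneCongruence R =
    (∀ {n} (x : P n) → R x x)
    × (∀ {n} {x y : P n} → R x y → R y x)
    × (∀ {n} {x y z : P n} → R x y → R y z → R x z)
    × (∀ {n m} {x x' : P n} {ys ys' : Fin n → P m}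
         → R x x' → (∀ j → R (ys j) (ys' j)) → R (x [ ys ]) (x' [ ys' ]))

{-# OPTIONS --safe #-}
-- Scanning a word from left to right, first_k only needs, for each value, the number of
-- occurrences seen so far, and only up to saturation at k. Hence a word w behaves exactly
-- like first_k(w) when it is embedded in a longer word: every letter w discards would
-- also be discarded there. This gives first_k(x[y]) = first_k(x[first_k ∘ y]). Moreover
-- once a value i has occurred k times in x, every value of y_i has occurred at least k
-- times in the prefix of x[y] already read, so the later copies of y_i contribute nothing:
-- first_k(x[y]) = first_k(first_k(x)[y]). Together,
-- first_k(x[y]) = first_k(first_k(x)[first_k ∘ y]), and the right-hand side only depends
-- on first_k(x) and the first_k(y_j).
module Submission where

open import Defs
open import Level using (Level; _⊔_)
open import Algebra.Bundles using (Monoid)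
open import Data.Nat using (ℕ; suc; _≤_; _<_; _<?_; z≤n; s≤s)
open import Data.Nat.Properties using (≤-refl; ≤-trans; <-≤-trans; ≤-<-trans; m≤n⇒m≤1+n; n≤1+n; ≮⇒≥; ≤⇒≯)
open import Data.Fin using (Fin; _≟_)
open import Data.Product using (_×_; _,_; proj₁; proj₂; map₁)
open import Data.Sum using (_⊎_; inj₁; inj₂)
open import Data.List using ([]; _∷_; _++_)
open import Data.List.Relation.Unary.Any using (Any; here; there)
open import Data.List.Relation.Binary.Pointwise as Pointwise using ([]; _∷_; ++⁺)
open import Data.List.Relation.Unary.Any.Properties as Any using ()
open import Relation.Binary.Bundles using (Setoid)
open import Relation.Binary.Structures using (IsEquivalence)
import Relation.Binary.Reasoning.Setoid as SetoidReasoning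
open import Relation.Binary.PropositionalEquality
  using (_≡_; refl; sym; trans; cong; cong₂; subst; subst₂; module ≡-Reasoning)
open import Relation.Nullary using (yes; no)
open import Relation.Nullary.Negation using (contradiction)

module FirstCongruence {a ℓ : Level} (M : Monoid a ℓ) (k : ℕ) where
  open Monoid M using (_≈_; ∙-cong) renaming (refl to ≈-refl; sym to ≈-sym; trans to ≈-trans)
  open Pigmented M

  Counter : ℕ → Set
  Counter n = Fin n → ℕ

  zeros : ∀ {n} → Counter n
  zeros _ = 0

  tick : ∀ {n} → Counter n → Fin n → Counter n
  tick c j i with i ≟ j
  ... | yes _ = suc (c i)
  ... | no _  = c i

  advance : ∀ {n} → Counter n → P n → Counter n
  advance c []            = c
  advance c ((j , _) ∷ w) = advance (tick c j) w

  firstFrom : ∀ {n} → Counter n → P n → P n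
  firstFrom c [] = []
  firstFrom c ((j , α) ∷ w) with c j <? k
  ... | yes _ = (j , α) ∷ firstFrom (tick c j) w
  ... | no _  = firstFrom (tick c j) w

  HasValue : ∀ {n} → Fin n → P n → Set a
  HasValue v = Any (λ l → proj₁ l ≡ v)

  _≤ᶜ_ : ∀ {n} → Counter n → Counter n → Set
  c ≤ᶜ c' = ∀ i → c i ≤ c' i

  tick-≤ : ∀ {n} (c : Counter n) j i → c i ≤ tick c j i
  tick-≤ c j i with i ≟ j
  ... | yes _ = n≤1+n _
  ... | no _  = ≤-refl

  tick-< : ∀ {n} (c : Counter n) j → c j < tick c j j
  tick-< c j with j ≟ j
  ... | yes _  = ≤-refl
  ... | no j≢j = contradiction refl j≢j

  tick-mono : ∀ {n} {e c : Counter n} → e ≤ᶜ c → ∀ j → tick e j ≤ᶜ tick c j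
  tick-mono e≤c j i with i ≟ j
  ... | yes _ = s≤s (e≤c i)
  ... | no _  = e≤c i

  advance-≤ : ∀ {n} (c : Counter n) w → c ≤ᶜ advance c w
  advance-≤ c []            i = ≤-refl
  advance-≤ c ((j , _) ∷ w) i = ≤-trans (tick-≤ c j i) (advance-≤ (tick c j) w i)

  advance-< : ∀ {n} (c : Counter n) w v → HasValue v w → c v < advance c w v
  advance-< c ((j , _) ∷ w) v (here refl) = <-≤-trans (tick-< c j) (advance-≤ (tick c j) w j)
  advance-< c ((j , _) ∷ w) v (there v∈w) = ≤-<-trans (tick-≤ c j v) (advance-< (tick c j) w v v∈w)

  advance-++ : ∀ {n} (c : Counter n) u v → advance c (u ++ v) ≡ advance (advance c u) v
  advance-++ c []            v = refl
  advance-++ c ((j , _) ∷ u) v = advance-++ (tick c j) u v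

  advance-⊙ : ∀ {n} (c : Counter n) β w → advance c (β ⊙ w) ≡ advance c w
  advance-⊙ c β []            = refl
  advance-⊙ c β ((j , _) ∷ w) = advance-⊙ (tick c j) β w

  _≃_ : ℕ → ℕ → Set
  m ≃ n = m ≡ n ⊎ (k ≤ m × k ≤ n)

  ≃-sym : ∀ {m n} → m ≃ n → n ≃ m
  ≃-sym (inj₁ m≡n)         = inj₁ (sym m≡n)
  ≃-sym (inj₂ (k≤m , k≤n)) = inj₂ (k≤n , k≤m)

  ≃-suc : ∀ {m n} → m ≃ n → suc m ≃ suc n
  ≃-suc (inj₁ m≡n)         = inj₁ (cong suc m≡n)
  ≃-suc (inj₂ (k≤m , k≤n)) = inj₂ (m≤n⇒m≤1+n k≤m , m≤n⇒m≤1+n k≤n)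

  ≃-<k : ∀ {m n} → m ≃ n → m < k → n < k
  ≃-<k (inj₁ refl)      m<k = m<k
  ≃-<k (inj₂ (k≤m , _)) m<k = contradiction m<k (≤⇒≯ k≤m)

  _≋_ : ∀ {n} → Counter n → Counter n → Set
  c ≋ c' = ∀ i → c i ≃ c' i

  ≋-refl : ∀ {n} {c : Counter n} → c ≋ c
  ≋-refl i = inj₁ refl

  ≋-tick : ∀ {n} {c c' : Counter n} → c ≋ c' → ∀ j → tick c j ≋ tick c' j
  ≋-tick c≋c' j i with i ≟ j
  ... | yes _ = ≃-suc (c≋c' i)
  ... | no _  = c≋c' i

  ≋-tick-saturated : ∀ {n} {c c' : Counter n} → c ≋ c' → ∀ j → k ≤ c j → tick c j ≋ c'
  ≋-tick-saturated c≋c' j k≤cj i with i ≟ j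
  ≋-tick-saturated c≋c' j k≤cj i | no _ = c≋c' i
  ≋-tick-saturated c≋c' j k≤cj i | yes refl with c≋c' i
  ... | inj₁ ci≡c'i      = inj₂ (m≤n⇒m≤1+n k≤cj , subst (k ≤_) ci≡c'i k≤cj)
  ... | inj₂ (k≤m , k≤n) = inj₂ (m≤n⇒m≤1+n k≤m , k≤n)

  record _∼_ {n} (w w' : P n) : Set a where
    field
      simulate : ∀ {c c'} → c ≋ c' → firstFrom c w ≡ firstFrom c' w' × advance c w ≋ advance c' w'
  open _∼_

  ∼-refl : ∀ {n} (w : P n) → w ∼ w
  ∼-refl [] .simulate c≋c' = refl , c≋c'
  ∼-refl ((j , α) ∷ w) .simulate {c} {c'} c≋c' with c j <? k | c' j <? k
  ... | yes _    | yes _     = map₁ (cong ((j , α) ∷_)) (∼-refl w .simulate (≋-tick c≋c' j))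
  ... | yes cj<k | no c'j≮k = contradiction (≃-<k (c≋c' j) cj<k) c'j≮k
  ... | no cj≮k  | yes c'j<k = contradiction (≃-<k (≃-sym (c≋c' j)) c'j<k) cj≮k
  ... | no _     | no _      = ∼-refl w .simulate (≋-tick c≋c' j)

  firstFrom-++ : ∀ {n} (c : Counter n) u v → firstFrom c (u ++ v) ≡ firstFrom c u ++ firstFrom (advance c u) v
  firstFrom-++ c []            v = refl
  firstFrom-++ c ((j , α) ∷ u) v with c j <? k
  ... | yes _ = cong ((j , α) ∷_) (firstFrom-++ (tick c j) u v)
  ... | no _  = firstFrom-++ (tick c j) u v

  firstFrom-⊙ : ∀ {n} (c : Counter n) β w → firstFrom c (β ⊙ w) ≡ β ⊙ firstFrom c w
  firstFrom-⊙ c β []            = refl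
  firstFrom-⊙ c β ((j , α) ∷ w) with c j <? k
  ... | yes _ = cong (_ ∷_) (firstFrom-⊙ (tick c j) β w)
  ... | no _  = firstFrom-⊙ (tick c j) β w

  ∼-++ : ∀ {n} {u u' v v' : P n} → u ∼ u' → v ∼ v' → (u ++ v) ∼ (u' ++ v')
  ∼-++ {u = u} {u'} {v} {v'} u∼u' v∼v' .simulate {c} {c'} c≋c' = first-eq , advance-≋
    where
      open ≡-Reasoning
      u-sim = u∼u' .simulate c≋c'
      v-sim = v∼v' .simulate (proj₂ u-sim)
      first-eq : firstFrom c (u ++ v) ≡ firstFrom c' (u' ++ v')
      first-eq = begin
        firstFrom c (u ++ v)                            ≡⟨ firstFrom-++ c u v ⟩
        firstFrom c u ++ firstFrom (advance c u) v      ≡⟨ cong₂ _++_ (proj₁ u-sim) (proj₁ v-sim) ⟩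
        firstFrom c' u' ++ firstFrom (advance c' u') v' ≡⟨ firstFrom-++ c' u' v' ⟨
        firstFrom c' (u' ++ v')                         ∎
      advance-≋ : advance c (u ++ v) ≋ advance c' (u' ++ v')
      advance-≋ = subst₂ _≋_ (sym (advance-++ c u v)) (sym (advance-++ c' u' v')) (proj₂ v-sim)

  ∼-⊙ : ∀ {n} β {w w' : P n} → w ∼ w' → (β ⊙ w) ∼ (β ⊙ w')
  ∼-⊙ β {w} {w'} w∼w' .simulate {c} {c'} c≋c' = first-eq , advance-≋
    where
      open ≡-Reasoning
      w-sim = w∼w' .simulate c≋c'
      first-eq : firstFrom c (β ⊙ w) ≡ firstFrom c' (β ⊙ w')
      first-eq = begin
        firstFrom c (β ⊙ w)  ≡⟨ firstFrom-⊙ c β w ⟩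
        β ⊙ firstFrom c w    ≡⟨ cong (β ⊙_) (proj₁ w-sim) ⟩
        β ⊙ firstFrom c' w'  ≡⟨ firstFrom-⊙ c' β w' ⟨
        firstFrom c' (β ⊙ w') ∎
      advance-≋ : advance c (β ⊙ w) ≋ advance c' (β ⊙ w')
      advance-≋ = subst₂ _≋_ (sym (advance-⊙ c β w)) (sym (advance-⊙ c' β w')) (proj₂ w-sim)

  ∼-superpose : ∀ {n m} (x : P n) {ys ys' : Fin n → P m} → (∀ j → ys j ∼ ys' j) → (x [ ys ]) ∼ (x [ ys' ])
  ∼-superpose []            ys∼ys' = ∼-refl []
  ∼-superpose ((i , α) ∷ x) ys∼ys' = ∼-++ (∼-⊙ α (ys∼ys' i)) (∼-superpose x ys∼ys')

  -- Filtering from counters e ≤ c first removes only letters that c would discard anyway.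
  firstFrom-absorb : ∀ {n} {e c c' : Counter n} → e ≤ᶜ c → c ≋ c' → ∀ w →
    firstFrom c w ≡ firstFrom c' (firstFrom e w) × advance c w ≋ advance c' (firstFrom e w)
  firstFrom-absorb e≤c c≋c' [] = refl , c≋c'
  firstFrom-absorb {e = e} {c} e≤c c≋c' ((j , α) ∷ w) with e j <? k
  ... | no ej≮k with c j <? k
  ...   | yes cj<k = contradiction (≤-<-trans (e≤c j) cj<k) ej≮k
  ...   | no _     = firstFrom-absorb (tick-mono e≤c j)
                       (≋-tick-saturated c≋c' j (≤-trans (≮⇒≥ ej≮k) (e≤c j))) w
  firstFrom-absorb {c = c} {c'} e≤c c≋c' ((j , α) ∷ w) | yes _ with c j <? k | c' j <? k
  ... | yes _    | yes _     = map₁ (cong ((j , α) ∷_)) (firstFrom-absorb (tick-mono e≤c j) (≋-tick c≋c' j) w)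
  ... | yes cj<k | no c'j≮k = contradiction (≃-<k (c≋c' j) cj<k) c'j≮k
  ... | no cj≮k  | yes c'j<k = contradiction (≃-<k (≃-sym (c≋c' j)) c'j<k) cj≮k
  ... | no _     | no _      = firstFrom-absorb (tick-mono e≤c j) (≋-tick c≋c' j) w

  tick-cong : ∀ {n} {c c' : Counter n} → (∀ i → c i ≡ c' i) → ∀ j i → tick c j i ≡ tick c' j i
  tick-cong c≗c' j i with i ≟ j
  ... | yes _ = cong suc (c≗c' i)
  ... | no _  = c≗c' i

  count-∷ʳ : ∀ {n} (pre : P n) j α i → count i (pre ++ (j , α) ∷ []) ≡ tick (λ t → count t pre) j i
  count-∷ʳ [] j α i with i ≟ j
  ... | yes _ = refl
  ... | no _  = refl
  count-∷ʳ ((j' , _) ∷ pre) j α i with i ≟ j | count-∷ʳ pre j α i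
  ... | yes _ | ih with i ≟ j'
  ...   | yes _ = cong suc ih
  ...   | no _  = ih
  count-∷ʳ ((j' , _) ∷ pre) j α i | no _ | ih with i ≟ j'
  ...   | yes _ = cong suc ih
  ...   | no _  = ih

  counts-∷ʳ : ∀ {n} (pre : P n) (c : Counter n) → (∀ i → count i pre ≡ c i) →
    ∀ j α i → count i (pre ++ (j , α) ∷ []) ≡ tick c j i
  counts-∷ʳ pre c counts j α i = trans (count-∷ʳ pre j α i) (tick-cong counts j i)

  firstAux≡firstFrom : ∀ {n} (pre : P n) (c : Counter n) → (∀ i → count i pre ≡ c i) → ∀ w →
    firstAux k pre w ≡ firstFrom c w
  firstAux≡firstFrom pre c counts [] = refl
  firstAux≡firstFrom pre c counts ((j , α) ∷ w) with count j pre <? k | c j <? k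
  ... | yes _    | yes _    = cong ((j , α) ∷_) (firstAux≡firstFrom _ _ (counts-∷ʳ pre c counts j α) w)
  ... | yes pj<k | no cj≮k  = contradiction (subst (_< k) (counts j) pj<k) cj≮k
  ... | no pj≮k  | yes cj<k = contradiction (subst (_< k) (sym (counts j)) cj<k) pj≮k
  ... | no _     | no _     = firstAux≡firstFrom _ _ (counts-∷ʳ pre c counts j α) w

  first≡firstFrom-zeros : ∀ {n} (w : P n) → first k w ≡ firstFrom zeros w
  first≡firstFrom-zeros = firstAux≡firstFrom [] zeros (λ _ → refl)

  ∼-first : ∀ {n} (w : P n) → w ∼ first k w
  ∼-first w .simulate {c} {c'} c≋c' =
    subst (λ v → firstFrom c w ≡ firstFrom c' v × advance c w ≋ advance c' v)
          (sym (first≡firstFrom-zeros w)) (firstFrom-absorb (λ _ → z≤n) c≋c' w)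

  firstFrom-saturated : ∀ {n} {c c' : Counter n} → c ≋ c' → ∀ w → (∀ v → HasValue v w → k ≤ c v) →
    firstFrom c w ≡ [] × advance c w ≋ c'
  firstFrom-saturated c≋c' [] saturated = refl , c≋c'
  firstFrom-saturated {c = c} c≋c' ((j , α) ∷ w) saturated with c j <? k
  ... | yes cj<k = contradiction cj<k (≤⇒≯ (saturated j (here refl)))
  ... | no _     = firstFrom-saturated (≋-tick-saturated c≋c' j (saturated j (here refl))) w
                     (λ v v∈w → ≤-trans (saturated v (there v∈w)) (tick-≤ c j v))

  -- d counts the letters of x read so far, c those of x[ys].
  Dominates : ∀ {n m} → (Fin n → P m) → Counter n → Counter m → Set a
  Dominates ys d c = ∀ i v → HasValue v (ys i) → d i ≤ c v

  dominates-step : ∀ {n m} {ys : Fin n → P m} {d c} → Dominates ys d c →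
    ∀ i α → Dominates ys (tick d i) (advance c (α ⊙ ys i))
  dominates-step {ys = ys} {c = c} dom i α i' v v∈ys with i' ≟ i
  ... | yes refl = ≤-trans (s≤s (dom i' v v∈ys)) (advance-< c (α ⊙ ys i') v (Any.map⁺ v∈ys))
  ... | no _     = ≤-trans (dom i' v v∈ys) (advance-≤ c (α ⊙ ys i) v)

  firstFrom-superpose-firstFrom : ∀ {n m} (ys : Fin n → P m) {d : Counter n} {c c' : Counter m} →
    c ≋ c' → Dominates ys d c → ∀ x → firstFrom c (x [ ys ]) ≡ firstFrom c' (firstFrom d x [ ys ])
  firstFrom-superpose-firstFrom ys c≋c' dom [] = refl
  firstFrom-superpose-firstFrom ys {d} {c} {c'} c≋c' dom ((i , α) ∷ x) with d i <? k
  ... | yes _ = begin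
    firstFrom c (block ++ x [ ys ])
      ≡⟨ firstFrom-++ c block (x [ ys ]) ⟩
    firstFrom c block ++ firstFrom (advance c block) (x [ ys ])
      ≡⟨ cong₂ _++_ (proj₁ kept) (firstFrom-superpose-firstFrom ys (proj₂ kept) (dominates-step dom i α) x) ⟩
    firstFrom c' block ++ firstFrom (advance c' block) (firstFrom (tick d i) x [ ys ])
      ≡⟨ firstFrom-++ c' block (firstFrom (tick d i) x [ ys ]) ⟨
    firstFrom c' (block ++ firstFrom (tick d i) x [ ys ]) ∎
    where
      open ≡-Reasoning
      block = α ⊙ ys i
      kept = ∼-refl block .simulate c≋c'
  ... | no di≮k = begin
    firstFrom c (block ++ x [ ys ])
      ≡⟨ firstFrom-++ c block (x [ ys ]) ⟩
    firstFrom c block ++ firstFrom (advance c block) (x [ ys ])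
      ≡⟨ cong (_++ firstFrom (advance c block) (x [ ys ])) (proj₁ dropped) ⟩
    firstFrom (advance c block) (x [ ys ])
      ≡⟨ firstFrom-superpose-firstFrom ys (proj₂ dropped) (dominates-step dom i α) x ⟩
    firstFrom c' (firstFrom (tick d i) x [ ys ]) ∎
    where
      open ≡-Reasoning
      block = α ⊙ ys i
      dropped = firstFrom-saturated c≋c' block
                  (λ v v∈block → ≤-trans (≮⇒≥ di≮k) (dom i v (Any.map⁻ v∈block)))

  first-superpose : ∀ {n m} (x : P n) (ys : Fin n → P m) →
    first k (x [ ys ]) ≡ firstFrom zeros (first k x [ (λ j → first k (ys j)) ])
  first-superpose x ys = begin
    first k (x [ ys ])                            ≡⟨ first≡firstFrom-zeros (x [ ys ]) ⟩
    firstFrom zeros (x [ ys ])                    ≡⟨ proj₁ (∼-superpose x (λ j → ∼-first (ys j)) .simulate ≋-refl) ⟩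
    firstFrom zeros (x [ firstys ])               ≡⟨ firstFrom-superpose-firstFrom firstys ≋-refl (λ _ _ _ → z≤n) x ⟩
    firstFrom zeros (firstFrom zeros x [ firstys ]) ≡⟨ cong (λ x′ → firstFrom zeros (x′ [ firstys ])) (first≡firstFrom-zeros x) ⟨
    firstFrom zeros (first k x [ firstys ])       ∎
    where
      open ≡-Reasoning
      firstys = λ j → first k (ys j)

  ≈L-isEquivalence : ∀ {n} → IsEquivalence (_≈L_ {n})
  ≈L-isEquivalence = record
    { refl  = refl , ≈-refl
    ; sym   = λ { (i≡j , α≈β) → sym i≡j , ≈-sym α≈β }
    ; trans = λ { (i≡j , α≈β) (j≡l , β≈γ) → trans i≡j j≡l , ≈-trans α≈β β≈γ }
    }

  wordSetoid : ℕ → Setoid a (a ⊔ ℓ)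
  wordSetoid n = Pointwise.setoid (record { isEquivalence = ≈L-isEquivalence {n} })

  module ≈W {n} = Setoid (wordSetoid n)

  ⊙-cong : ∀ {n} {α β} {w w' : P n} → α ≈ β → w ≈W w' → (α ⊙ w) ≈W (β ⊙ w')
  ⊙-cong α≈β []                  = []
  ⊙-cong α≈β ((i≡j , γ≈δ) ∷ w≈w') = (i≡j , ∙-cong α≈β γ≈δ) ∷ ⊙-cong α≈β w≈w'

  superpose-cong : ∀ {n m} {x x' : P n} {ys ys' : Fin n → P m} → x ≈W x' → (∀ j → ys j ≈W ys' j) →
    (x [ ys ]) ≈W (x' [ ys' ])
  superpose-cong [] ys≈ys' = []
  superpose-cong {x = (i , _) ∷ _} ((refl , α≈β) ∷ x≈x') ys≈ys' =
    ++⁺ (⊙-cong α≈β (ys≈ys' i)) (superpose-cong x≈x' ys≈ys')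

  firstFrom-cong : ∀ {n} (c : Counter n) {w w' : P n} → w ≈W w' → firstFrom c w ≈W firstFrom c w'
  firstFrom-cong c [] = []
  firstFrom-cong c {(j , _) ∷ _} ((refl , α≈β) ∷ w≈w') with c j <? k
  ... | yes _ = (refl , α≈β) ∷ firstFrom-cong (tick c j) w≈w'
  ... | no _  = firstFrom-cong (tick c j) w≈w'

  superpose-preserves-≡first : ∀ {n m} {x x' : P n} {ys ys' : Fin n → P m} →
    x ≡first[ k ] x' → (∀ j → ys j ≡first[ k ] ys' j) → (x [ ys ]) ≡first[ k ] (x' [ ys' ])
  superpose-preserves-≡first {m = m} {x} {x'} {ys} {ys'} x≡x' ys≡ys' = begin
    first k (x [ ys ])                                         ≡⟨ first-superpose x ys ⟩
    firstFrom zeros (first k x [ (λ j → first k (ys j)) ])     ≈⟨ firstFrom-cong zeros (superpose-cong x≡x' ys≡ys') ⟩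
    firstFrom zeros (first k x' [ (λ j → first k (ys' j)) ])   ≡⟨ first-superpose x' ys' ⟨
    first k (x' [ ys' ])                                       ∎
    where open SetoidReasoning (wordSetoid m)

proposition4p2p3 : ∀ {c ℓ : Level} (M : Monoid c ℓ) (k : ℕ) → IsCloneCongruence M (λ p p' → Pigmented._≡first[_]_ M p k p')
proposition4p2p3 M k =
  (λ _ → ≈W.refl) , ≈W.sym , ≈W.trans ,
  λ {_} {_} {x} {x'} {ys} {ys'} → superpose-preserves-≡first {x = x} {x'} {ys} {ys'}
  where open FirstCongruence M k
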